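{- For every epoch $\mathcal{E}$, conditioned on any fixed outcome of all random choices made by the algorithm before $\chi(\mathcal{E})$ is sampled, the probability that $\mathcal{E}$ is short is at most $\frac{1}{16e}$. (In particular this bound holds independently of all random bits of the algorithm other than those used to sample $\chi(\mathcal{E})$.)
   Context: Setting: $G=(V,E)$ is a dynamic graph on a fixed set $V$ of $n$ vertices that starts with no edges and undergoes a sequence of updates, each the insertion or deletion of one edge; the update sequence is fixed in advance, independently of the algorithm's random choices. A fixed integer $\Delta>0$ upper-bounds the maximum degree of $G$ at all times, and $\mathcal{C}=\{1,\dots,\Delta+1\}$ is the set of colors. Let $L=\lceil\log_3(n-1)\rceil-1$. The algorithm maintains a coloring $\chi:V\to\mathcal{C}$ and a level $\ell(v)\in\{ -1,0,\dots,L\}$ for each vertex $v$. For an edge $uv$, $u$ is an up-neighbor of $v$ if $\ell(u)\ge\ell(v)$ and a down-neighbor of $v$ if $\ell(u)<\ell(v)$. For a level $k$, $\phi_v(k)$ is the number of neighbors $u$ of $v$ with $\ell(u)<k$. A color $c$ is blank for $v$ if no neighbor of $v$ has color $c$, and unique for $v$ if no up-neighbor of $v$ has color $c$ and exactly one down-neighbor of $v$ has color $c$. Algorithm: initially every vertex is at level $-1$ with an arbitrary color. A deletion changes nothing. On insertion of an edge $uv$: if $\chi(u)\neq\chi(v)$ nothing changes; otherwise let $x$ be the endpoint among $u,v$ that was recolored most recently, and repeat $x\leftarrow\texttt{recolor}(x)$ until $x=\mathrm{NULL}$. The procedure $\texttt{recolor}(x)$: if $\phi_x(\ell(x)+1)<3^{\ell(x)+2}$,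 call $\texttt{det-color}(x)$, which assigns to $x$ a deterministically chosen blank color, sets $\ell(x)=-1$, and then return NULL. Otherwise call $\texttt{rand-color}(x)$, which: lets $\ell'$ be the minimum level $\ell'>\ell(x)$ with $\phi_x(\ell'+1)<3^{\ell'+2}$ and sets $\ell(x)=\ell'$; lets the palette $\mathcal{C}^*_x$ be the set of colors that are blank or unique for $x$; picks $c\in\mathcal{C}^*_x$ uniformly at random and sets $\chi(x)=c$; returns NULL if $c$ is blank for $x$, and otherwise returns the unique down-neighbor $y$ of $x$ with $\chi(y)=c$. Epochs: an epoch $\mathcal{E}$ of a vertex $v=v(\mathcal{E})$ is a maximal time interval during which $v$ keeps the same color; it starts with a call to $\texttt{recolor}(v)$ and ends immediately before the next call to $\texttt{recolor}(v)$, if any; $\ell(\mathcal{E})$ and $\chi(\mathcal{E})$ are the level and color of $v$ during $\mathcal{E}$. Pseudo-duration: let $C$ be the palette from which $\chi(\mathcal{E})$ was sampled (if $\mathcal{E}$ starts with $\texttt{det-color}$, $C$ consists of the single chosen color). Let $vu_1,\dots,vu_q$ be the subsequence of all insertions of edges incident to $v$ in the update sequence after the creation of $\mathcal{E}$, and let $\chi(u_i)$ denote the color of $u_i$ right before the creation of $\mathcal{E}$. From the sequence $\chi(u_1),\dots,\chi(u_q)$ remove all colors not in $C$ and keep only the first occurrence of each repeated color; if the resulting sequence of distinct colors does not contain all of $C$, extend it by appending the missing colors of $C$ in an arbitrary order (determined before $\chi(\mathcal{E})$ is sampled), obtaining a permutation $\chi(1),\dots,\chi(|C|)$ of $C$.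 Then $psdur(\mathcal{E})$ is the index $i$ with $\chi(i)=\chi(\mathcal{E})$. The epoch $\mathcal{E}$ is short if $psdur(\mathcal{E})\le\frac{1}{32e}3^{\ell(\mathcal{E})}$, and long otherwise. -}

module Defs where

open import Data.Nat using (ℕ; zero; suc; _+_; _*_; _^_; _≤_; _<ᵇ_; _≤ᵇ_; _≡ᵇ_)
open import Data.Bool using (Bool; true; false; _∧_; _∨_; not; if_then_else_)
open import Data.Fin using (Fin)
import Data.Fin as F
open import Data.List using (List; []; _∷_; [_]; length; filterᵇ; allFin; lookup; drop; concatMap; _++_)
open import Data.Maybe using (Maybe; just; nothing)
open import Data.Product using (Σ; _×_; _,_; proj₁; proj₂)
open import Data.Unit using (⊤)
open import Relation.Nullary using (¬_)
open import Relation.Nullary.Decidable using (⌊_⌋)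
open import Relation.Binary.PropositionalEquality using (_≡_; _≢_)
open import Data.List.Relation.Unary.All using (All)
open import Data.List.Relation.Unary.Unique.Propositional using (Unique)

-- Euler's number e, via its partial sums  s_N = Σ_{k=0}^{N} 1/k!.
-- fact N = N!,  eNum N = N! * s_N = Σ_{k=0}^{N} N!/k!  (a natural number),
-- computed by the recurrence eNum 0 = 1, eNum (N+1) = (N+1) * eNum N + 1.
-- Since s_N increases to e:  a * e ≤ b  ⇔  ∀ N → a * eNum N ≤ b * fact N.

fact : ℕ → ℕ
fact zero    = 1
fact (suc N) = suc N * fact N

eNum : ℕ → ℕ
eNum zero    = 1
eNum (suc N) = suc N * eNum N + 1

-- The algorithm, for n vertices (Fin n) and colours C = Fin (suc Δ)
-- (colour i ∈ Fin (suc Δ) stands for the colour i+1 ∈ {1,…,Δ+1}).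

module Alg (n Δ : ℕ) where

  Vertex : Set
  Vertex = Fin n

  Color : Set
  Color = Fin (suc Δ)

  _==_ : ∀ {k} → Fin k → Fin k → Bool
  a == b = ⌊ a F.≟ b ⌋

  Graph : Set
  Graph = Vertex → Vertex → Bool

  empty : Graph
  empty _ _ = false

  cnt : (Vertex → Bool) → ℕ
  cnt p = length (filterᵇ p (allFin n))

  deg : Graph → Vertex → ℕ
  deg g v = cnt (g v)

  data Update : Set where
    ins : Vertex → Vertex → Update
    del : Vertex → Vertex → Update

  setEdge : Graph → Vertex → Vertex → Bool → Graph
  setEdge g u v b a c = if (a == u ∧ c == v) ∨ (a == v ∧ c == u) then b else g a c

  applyU : Graph → Update → Graph
  applyU g (ins u v) = setEdge g u v true
  applyU g (del u v) = setEdge g u v false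

  ValidUpd : Graph → Update → Set
  ValidUpd g (ins u v) = (u ≢ v) × (g u v ≡ false)
  ValidUpd g (del u v) = g u v ≡ true

  validFrom : Graph → List Update → Set
  validFrom g []       = ⊤
  validFrom g (a ∷ as) = ValidUpd g a × ((v : Vertex) → deg (applyU g a) v ≤ Δ) × validFrom (applyU g a) as

  -- Levels are stored SHIFTED by one: lev v = ℓ(v) + 1 ∈ {0,…,L+1}.
  -- stamp v = time of the most recent recolouring of v (0 = never recoloured).
  -- time = number of updates already processed; pending = current x of the recolour loop.
  record State : Set where
    field
      graph   : Graph
      col     : Vertex → Color
      lev     : Vertex → ℕ
      stamp   : Vertex → ℕ
      clock   : ℕ
      pending : Maybe Vertex
      time    : ℕ
  open State public

  upd : {A : Set} → (Vertex → A) → Vertex → A → Vertex → A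
  upd f x a u = if u == x then a else f u

  -- φ_v(k) for the real level k = m - 1 (m a shifted level): neighbours u with lev u < m
  phi : Graph → (Vertex → ℕ) → Vertex → ℕ → ℕ
  phi g lv v m = cnt (λ u → g v u ∧ (lv u <ᵇ m))

  blankᵇ : Graph → (Vertex → Color) → Vertex → Color → Bool
  blankᵇ g cl v c = cnt (λ u → g v u ∧ (cl u == c)) ≡ᵇ 0

  uniqueᵇ : Graph → (Vertex → Color) → (Vertex → ℕ) → Vertex → Color → Bool
  uniqueᵇ g cl lv v c =
    (cnt (λ u → g v u ∧ (lv v ≤ᵇ lv u) ∧ (cl u == c)) ≡ᵇ 0)
    ∧ (cnt (λ u → g v u ∧ (lv u <ᵇ lv v) ∧ (cl u == c)) ≡ᵇ 1)

  -- test of recolor(x): φ_x(ℓ(x)+1) < 3^(ℓ(x)+2), i.e. det-color is used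
  isDet : State → Vertex → Bool
  isDet s x = phi (graph s) (lev s) x (suc (lev s x)) <ᵇ 3 ^ suc (lev s x)

  -- least shifted level m ≥ start with φ_x(real m + 1) < 3^(real m + 2);
  -- the fuel n suffices since φ_x(·) ≤ n - 1 < 3^(m+1) once m + 1 ≥ n.
  search : State → Vertex → ℕ → ℕ → ℕ
  search s x zero    m = m
  search s x (suc f) m =
    if phi (graph s) (lev s) x (suc m) <ᵇ 3 ^ suc m then m else search s x f (suc m)

  newLev : State → Vertex → ℕ
  newLev s x = search s x (suc n) (suc (lev s x))

  levAfter : State → Vertex → Vertex → ℕ
  levAfter s x = upd (lev s) x (newLev s x)

  palette : State → Vertex → List Color
  palette s x = filterᵇ (λ c → blankᵇ (graph s) (col s) x c ∨ uniqueᵇ (graph s) (col s) (levAfter s x) x c)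
                        (allFin (suc Δ))

  firstᵇ : (Vertex → Bool) → List Vertex → Maybe Vertex
  firstᵇ p []       = nothing
  firstᵇ p (u ∷ us) = if p u then just u else firstᵇ p us

  downNbr : State → Vertex → Color → Maybe Vertex
  downNbr s x c = firstᵇ (λ u → graph s x u ∧ (levAfter s x u <ᵇ newLev s x) ∧ (col s u == c)) (allFin n)

  DetRule : Set
  DetRule = State → Vertex → Color

  DetOK : DetRule → Set
  DetOK detC = (s : State) (x : Vertex) →
    Σ Color (λ c → blankᵇ (graph s) (col s) x c ≡ true) →
    blankᵇ (graph s) (col s) x (detC s x) ≡ true

  initState : (Vertex → Color) → State
  initState χ₀ = record { graph = empty ; col = χ₀ ; lev = λ _ → 0 ; stamp = λ _ → 0
                        ; clock = 0 ; pending = nothing ; time = 0 }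

  afterUpd : State → Update → State
  afterUpd s a = record s { graph = applyU (graph s) a ; time = suc (time s) ; pending = p a }
    where
      p : Update → Maybe Vertex
      p (ins u v) = if col s u == col s v
                      then just (if stamp s v ≤ᵇ stamp s u then u else v)
                      else nothing
      p (del u v) = nothing

  afterDet : DetRule → State → Vertex → State
  afterDet detC s x = record s
    { col = upd (col s) x (detC s x) ; lev = upd (lev s) x 0
    ; stamp = upd (stamp s) x (suc (clock s)) ; clock = suc (clock s) ; pending = nothing }

  afterRand : (s : State) (x : Vertex) → Fin (length (palette s x)) → State
  afterRand s x i = record s
    { col = upd (col s) x c ; lev = levAfter s x
    ; stamp = upd (stamp s) x (suc (clock s)) ; clock = suc (clock s)
    ; pending = if blankᵇ (graph s) (col s) x c then nothing else downNbr s x c }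
    where c = lookup (palette s x) i

  -- States reachable for the fixed update sequence us, det-rule detC and initial colouring χ₀,
  -- under SOME outcome of the random choices (index i into the palette at each rand-color).
  -- A derivation of Reach s is exactly a fixed outcome of all random choices made so far.
  data Reach (us : List Update) (detC : DetRule) (χ₀ : Vertex → Color) : State → Set where
    init : Reach us detC χ₀ (initState χ₀)
    step-upd : ∀ {s a rest} → Reach us detC χ₀ s → pending s ≡ nothing →
               drop (time s) us ≡ a ∷ rest → Reach us detC χ₀ (afterUpd s a)
    step-det : ∀ {s x} → Reach us detC χ₀ s → pending s ≡ just x → isDet s x ≡ true →
               Reach us detC χ₀ (afterDet detC s x)
    step-rand : ∀ {s x} → Reach us detC χ₀ s → pending s ≡ just x → isDet s x ≡ false →
                (i : Fin (length (palette s x))) → Reach us detC χ₀ (afterRand s x i)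

  -- The epoch created by recolor(x) in state s: its (shifted) level and the palette C
  -- from which its colour is sampled (a singleton for det-color).
  epochLev : State → Vertex → ℕ
  epochLev s x = if isDet s x then 0 else newLev s x

  epochPal : DetRule → State → Vertex → List Color
  epochPal detC s x = if isDet s x then [ detC s x ] else palette s x

  memᵇ : Color → List Color → Bool
  memᵇ c []       = false
  memᵇ c (d ∷ ds) = (c == d) ∨ memᵇ c ds

  dedup : List Color → List Color → List Color
  dedup seen []       = []
  dedup seen (c ∷ cs) = if memᵇ c seen then dedup seen cs else c ∷ dedup (c ∷ seen) cs

  -- colours (right before the creation of the epoch) of the other endpoints of the
  -- insertions of edges incident to x after the creation of the epoch
  futureCols : List Update → State → Vertex → List Color
  futureCols us s x = concatMap f (drop (time s) us)
    where
      f : Update → List Color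
      f (ins a b) = if a == x then [ col s b ] else (if b == x then [ col s a ] else [])
      f (del a b) = []

  -- the permutation χ(1),…,χ(|C|) of C; missing colours appended in the (fixed) order of C
  psPerm : List Update → State → Vertex → List Color → List Color
  psPerm us s x C = ded ++ filterᵇ (λ c → not (memᵇ c ded)) C
    where ded = dedup [] (filterᵇ (λ c → memᵇ c C) (futureCols us s x))

  indexOf : Color → List Color → ℕ
  indexOf c []       = 0
  indexOf c (d ∷ ds) = if c == d then 0 else suc (indexOf c ds)

  psdur : List Update → State → Vertex → List Color → Color → ℕ
  psdur us s x C c = suc (indexOf c (psPerm us s x C))

  -- the epoch created in state s for x, with palette C, level lv (shifted) and colour c, is short:
  --   psdur ≤ 3^ℓ / (32 e)  with ℓ = lv - 1,  i.e.  96 · e · psdur ≤ 3^lv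
  IsShort : List Update → State → Vertex → ℕ → List Color → Color → Set
  IsShort us s x lv C c = (N : ℕ) → 96 * psdur us s x C c * eNum N ≤ 3 ^ lv * fact N

  -- Conditioned on the past (state s), the colour is uniform over C = epochPal;
  -- "Pr[short] ≤ 1/(16e)" means: every set S of palette positions giving a short epoch
  -- has |S| / |C| ≤ 1/(16e), i.e. 16 · e · |S| ≤ |C|.
  ShortProbBound : List Update → DetRule → State → Vertex → Set
  ShortProbBound us detC s x =
    (S : List (Fin (length (epochPal detC s x)))) → Unique S →
    All (λ i → IsShort us s x (epochLev s x) (epochPal detC s x) (lookup (epochPal detC s x) i)) S →
    (N : ℕ) → 16 * length S * eNum N ≤ length (epochPal detC s x) * fact N

-- Conditioned on the past, χ(E) is uniform on the palette C, and the pseudo-duration is a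
-- bijection from C onto {1,…,|C|}; so the number of colours giving a short epoch is at most
-- 3^ℓ / (32e). Since rand-color picks the least admissible level, the test failed one level
-- below: 3^(ℓ+1) ≤ φ_x(ℓ+1) ≤ D + 1, where D counts the down-neighbours of x. A colour outside
-- the palette is used by an up-neighbour or by two down-neighbours, so with deg x ≤ Δ the
-- palette has at least D/2 + 1 colours. Hence at most 3^(ℓ+1)/(96e) ≤ |C|/(48e) colours are short.
module Submission where

open import Data.Bool using (Bool; true; false; _∧_; _∨_; not; T)
open import Data.Bool.Properties using (∧-assoc)
open import Data.Fin using (Fin; zero; suc; _≟_; fromℕ<)
import Data.Fin.Properties as Fin
open import Data.List using (List; []; _∷_; length; filterᵇ; tabulate; lookup; map; drop; _++_)
open import Data.List.Properties using (length-map)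
open import Data.List.Membership.Propositional using (_∈_)
open import Data.List.Membership.Propositional.Properties
  using (∈-lookup; ∈-++⁺ˡ; ∈-++⁺ʳ; ∈-filter⁺)
open import Data.List.Relation.Unary.All as All using (All; []; _∷_)
import Data.List.Relation.Unary.All.Properties as All
open import Data.List.Relation.Unary.Any as Any using (here; there)
open import Data.List.Relation.Unary.AllPairs using ([]; _∷_)
open import Data.List.Relation.Unary.Unique.Propositional using (Unique)
import Data.List.Relation.Unary.Unique.Propositional.Properties as Unique
open import Data.Maybe using (just)
open import Data.Nat
  using (ℕ; zero; suc; _+_; _*_; _^_; _≤_; _<_; _<ᵇ_; _≤ᵇ_; _≡ᵇ_; z≤n; s≤s; NonZero)
open import Data.Nat.DivMod using (_/_; m*n/n≡m; /-monoˡ-≤; m/n*n≤m)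
open import Data.Nat.Properties hiding (_≟_)
open import Data.Nat.Solver using (module +-*-Solver)
open import Data.Product using (proj₁; proj₂)
open import Function using (_∘_; id)
open import Relation.Nullary using (yes; no; contradiction)
open import Relation.Nullary.Decidable using (⌊_⌋; T?; ⌊⌋-map′)
open import Relation.Binary.PropositionalEquality
open import Algebra.Properties.Semiring.Sum +-*-semiring
  using (sum; sum-syntax; sum-cong-≗; sum-replicate-zero; ∑-distrib-+; ∑-comm; *-distribˡ-sum)

open import Defs

𝟙 : Bool → ℕ
𝟙 true  = 1
𝟙 false = 0

𝟙≤1 : ∀ b → 𝟙 b ≤ 1
𝟙≤1 true  = ≤-refl
𝟙≤1 false = z≤n

𝟙-∧ : ∀ a b → 𝟙 (a ∧ b) ≡ 𝟙 a * 𝟙 b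
𝟙-∧ true  b = sym (+-identityʳ (𝟙 b))
𝟙-∧ false b = refl

𝟙-complement : ∀ b → 𝟙 b + 𝟙 (not b) ≡ 1
𝟙-complement true  = refl
𝟙-complement false = refl

𝟙-split : ∀ a b c → 𝟙 (a ∧ c) ≡ 𝟙 (a ∧ b ∧ c) + 𝟙 (a ∧ not b ∧ c)
𝟙-split false b     c     = refl
𝟙-split true  false c     = refl
𝟙-split true  true  false = refl
𝟙-split true  true  true  = refl

<ᵇ-suc : ∀ a b → (a <ᵇ suc b) ≡ (a ≤ᵇ b)
<ᵇ-suc zero    b = refl
<ᵇ-suc (suc a) b = refl

not-≤ᵇ : ∀ a b → not (a ≤ᵇ b) ≡ (b <ᵇ a)
not-≤ᵇ zero    b       = refl
not-≤ᵇ (suc a) zero    = refl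
not-≤ᵇ (suc a) (suc b) = trans (cong not (<ᵇ-suc a b)) (not-≤ᵇ a b)

<ᵇ-false⇒≥ : ∀ {a b} → (a <ᵇ b) ≡ false → b ≤ a
<ᵇ-false⇒≥ a≮b = ≮⇒≥ (λ a<b → subst T a≮b (<⇒<ᵇ a<b))

∑-mono-≤ : ∀ {k} {f g : Fin k → ℕ} → (∀ i → f i ≤ g i) → sum f ≤ sum g
∑-mono-≤ {zero}  f≤g = z≤n
∑-mono-≤ {suc k} f≤g = +-mono-≤ (f≤g zero) (∑-mono-≤ (f≤g ∘ suc))

∑-const-1 : ∀ k → ∑[ i < k ] 1 ≡ k
∑-const-1 zero    = refl
∑-const-1 (suc k) = cong suc (∑-const-1 k)

count : ∀ {k} → (Fin k → Bool) → ℕ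
count {k} p = ∑[ i < k ] 𝟙 (p i)

count-cong : ∀ {k} {p q : Fin k → Bool} → (∀ i → p i ≡ q i) → count p ≡ count q
count-cong p≗q = sum-cong-≗ (cong 𝟙 ∘ p≗q)

length-filterᵇ-tabulate : ∀ {A : Set} {k} (p : A → Bool) (f : Fin k → A) →
                          length (filterᵇ p (tabulate f)) ≡ count (p ∘ f)
length-filterᵇ-tabulate {k = zero}  p f = refl
length-filterᵇ-tabulate {k = suc k} p f with p (f zero)
... | true  = cong suc (length-filterᵇ-tabulate p (f ∘ suc))
... | false = length-filterᵇ-tabulate p (f ∘ suc)

count-complement : ∀ {k} (p : Fin k → Bool) → count p + count (not ∘ p) ≡ k
count-complement {k} p = begin
  count p + count (not ∘ p)             ≡⟨ ∑-distrib-+ (𝟙 ∘ p) (𝟙 ∘ not ∘ p) ⟨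
  ∑[ i < k ] (𝟙 (p i) + 𝟙 (not (p i)))  ≡⟨ sum-cong-≗ (𝟙-complement ∘ p) ⟩
  ∑[ i < k ] 1                          ≡⟨ ∑-const-1 k ⟩
  k                                     ∎
  where open ≡-Reasoning

count-≟ : ∀ {k} (a : Fin k) → count (λ i → ⌊ a ≟ i ⌋) ≡ 1
count-≟ {suc k} zero    = cong suc (sum-replicate-zero k)
count-≟ {suc k} (suc a) = trans (count-cong (λ i → ⌊⌋-map′ _ _ (a ≟ i))) (count-≟ a)

count-partition : ∀ {m k} (p : Fin m → Bool) (f : Fin m → Fin k) →
                  ∑[ c < k ] count (λ i → p i ∧ ⌊ f i ≟ c ⌋) ≡ count p
count-partition {m} {k} p f = begin
  ∑[ c < k ] (∑[ i < m ] 𝟙 (p i ∧ δ i c))       ≡⟨ ∑-comm (λ c i → 𝟙 (p i ∧ δ i c)) ⟩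
  ∑[ i < m ] (∑[ c < k ] 𝟙 (p i ∧ δ i c))       ≡⟨ sum-cong-≗ (λ i → sum-cong-≗ (𝟙-∧ (p i) ∘ δ i)) ⟩
  ∑[ i < m ] (∑[ c < k ] (𝟙 (p i) * 𝟙 (δ i c))) ≡⟨ sum-cong-≗ (λ i → *-distribˡ-sum (𝟙 (p i)) (𝟙 ∘ δ i)) ⟨
  ∑[ i < m ] (𝟙 (p i) * count (δ i))            ≡⟨ sum-cong-≗ (λ i → cong (𝟙 (p i) *_) (count-≟ (f i))) ⟩
  ∑[ i < m ] (𝟙 (p i) * 1)                      ≡⟨ sum-cong-≗ (*-identityʳ ∘ 𝟙 ∘ p) ⟩
  count p                                       ∎
  where
    open ≡-Reasoning
    δ : Fin m → Fin k → Bool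
    δ i c = ⌊ f i ≟ c ⌋

count-split-≤ᵇ : ∀ {k} (p r : Fin k → Bool) (lv : Fin k → ℕ) l →
                 count (λ i → p i ∧ r i) ≡
                 count (λ i → p i ∧ (l ≤ᵇ lv i) ∧ r i) + count (λ i → p i ∧ (lv i <ᵇ l) ∧ r i)
count-split-≤ᵇ {k} p r lv l = trans (sum-cong-≗ split) (∑-distrib-+ (𝟙 ∘ above) (𝟙 ∘ below))
  where
    above below : Fin k → Bool
    above i = p i ∧ (l ≤ᵇ lv i) ∧ r i
    below i = p i ∧ (lv i <ᵇ l) ∧ r i
    split : ∀ i → 𝟙 (p i ∧ r i) ≡ 𝟙 (above i) + 𝟙 (below i)
    split i = trans (𝟙-split (p i) (l ≤ᵇ lv i) (r i))
                    (cong (λ b → 𝟙 (above i) + 𝟙 (p i ∧ b ∧ r i)) (not-≤ᵇ l (lv i)))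

BlankOrUnique : ℕ → ℕ → Bool
BlankOrUnique up down = (up + down ≡ᵇ 0) ∨ ((up ≡ᵇ 0) ∧ (down ≡ᵇ 1))

2*𝟙[¬BlankOrUnique]≤ : ∀ up down → 2 * 𝟙 (not (BlankOrUnique up down)) ≤ 2 * up + down
2*𝟙[¬BlankOrUnique]≤ (suc up) down          = ≤-trans (*-monoʳ-≤ 2 (s≤s z≤n)) (m≤m+n _ down)
2*𝟙[¬BlankOrUnique]≤ zero    zero           = z≤n
2*𝟙[¬BlankOrUnique]≤ zero    (suc zero)     = z≤n
2*𝟙[¬BlankOrUnique]≤ zero    (suc (suc _))  = s≤s (s≤s z≤n)

∑down+2≤2*count-BlankOrUnique : ∀ {k} (up down : Fin (suc k) → ℕ) → sum up + sum down ≤ k →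
                      sum down + 2 ≤ 2 * count (λ c → BlankOrUnique (up c) (down c))
∑down+2≤2*count-BlankOrUnique {k} up down ∑≤k = +-cancelʳ-≤ (2 * Q) (sum down + 2) (2 * P) (begin
  sum down + 2 + 2 * Q                     ≤⟨ +-monoʳ-≤ (sum down + 2) 2*Q≤ ⟩
  sum down + 2 + (2 * sum up + sum down)   ≡⟨ solve 2 (λ u d → d :+ con 2 :+ (con 2 :* u :+ d)
                                                          := con 2 :* (u :+ d) :+ con 2)
                                                   refl (sum up) (sum down) ⟩
  2 * (sum up + sum down) + 2              ≤⟨ +-monoˡ-≤ 2 (*-monoʳ-≤ 2 ∑≤k) ⟩
  2 * k + 2                                ≡⟨ trans (+-comm (2 * k) 2) (sym (*-suc 2 k)) ⟩
  2 * suc k                                ≡⟨ cong (2 *_) (count-complement pal) ⟨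
  2 * (P + Q)                              ≡⟨ *-distribˡ-+ 2 P Q ⟩
  2 * P + 2 * Q                            ∎)
  where
    open +-*-Solver
    open ≤-Reasoning
    pal : Fin (suc k) → Bool
    pal c = BlankOrUnique (up c) (down c)
    P Q : ℕ
    P = count pal
    Q = count (not ∘ pal)
    2*Q≤ : 2 * Q ≤ 2 * sum up + sum down
    2*Q≤ = begin
      2 * Q                                    ≡⟨ *-distribˡ-sum 2 (𝟙 ∘ not ∘ pal) ⟩
      ∑[ c < suc k ] (2 * 𝟙 (not (pal c)))     ≤⟨ ∑-mono-≤ (λ c → 2*𝟙[¬BlankOrUnique]≤ (up c) (down c)) ⟩
      ∑[ c < suc k ] (2 * up c + down c)       ≡⟨ ∑-distrib-+ (λ c → 2 * up c) down ⟩
      ∑[ c < suc k ] (2 * up c) + sum down     ≡⟨ cong (_+ sum down) (*-distribˡ-sum 2 up) ⟨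
      2 * sum up + sum down                    ∎

lookup-injective : ∀ {A : Set} {xs : List A} → Unique xs →
                   ∀ {i j} → lookup xs i ≡ lookup xs j → i ≡ j
lookup-injective (_ ∷ _)         {zero}  {zero}  _ = refl
lookup-injective (x∉xs ∷ _)      {zero}  {suc j} e = contradiction e (All.lookup x∉xs (∈-lookup j))
lookup-injective (x∉xs ∷ _)      {suc i} {zero}  e = contradiction (sym e) (All.lookup x∉xs (∈-lookup i))
lookup-injective (_ ∷ xs-unique) {suc i} {suc j} e = cong suc (lookup-injective xs-unique e)

Unique⇒length≤ : ∀ {ks : List ℕ} {B} → Unique ks → All (_< B) ks → length ks ≤ B
Unique⇒length≤ {ks} {B} ks-unique ks<B = Fin.injective⇒≤ {f = bounded} bounded-injective
  where
    bounded : Fin (length ks) → Fin B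
    bounded i = fromℕ< (All.lookup ks<B (∈-lookup i))
    bounded-injective : ∀ {i j} → bounded i ≡ bounded j → i ≡ j
    bounded-injective e = lookup-injective ks-unique (Fin.fromℕ<-injective _ _ _ _ e)

Unique⇒length*≤ : ∀ {ks : List ℕ} d .{{_ : NonZero d}} {t} →
                  Unique ks → All (λ k → suc k * d ≤ t) ks → length ks * d ≤ t
Unique⇒length*≤ {ks} d {t} ks-unique bounds = begin
  length ks * d  ≤⟨ *-monoˡ-≤ d (Unique⇒length≤ ks-unique (All.map below bounds)) ⟩
  t / d * d      ≤⟨ m/n*n≤m t d ⟩
  t              ∎
  where
    open ≤-Reasoning
    below : ∀ {k} → suc k * d ≤ t → k < t / d
    below {k} h = subst (_≤ t / d) (m*n/n≡m (suc k) d) (/-monoˡ-≤ d h)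

drop-suc : ∀ {A : Set} t {xs : List A} {a rest} → drop t xs ≡ a ∷ rest → drop (suc t) xs ≡ rest
drop-suc zero    {_ ∷ _}  refl = refl
drop-suc (suc t) {_ ∷ xs} e    = drop-suc t e

eNum-nonZero : ∀ N → NonZero (eNum N)
eNum-nonZero zero    = _
eNum-nonZero (suc N) = subst NonZero (+-comm 1 (suc N * eNum N)) _

module _ (n Δ : ℕ) where
  open Alg n Δ

  upd-same : ∀ {A : Set} (f : Vertex → A) x a → upd f x a x ≡ a
  upd-same f x a with x ≟ x
  ... | yes _  = refl
  ... | no x≢x = contradiction refl x≢x

  upd-other : ∀ {A : Set} (f : Vertex → A) {x} a {u} → u ≢ x → upd f x a u ≡ f u
  upd-other f {x} a {u} u≢x with u ≟ x
  ... | yes u≡x = contradiction u≡x u≢x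
  ... | no _    = refl

  cnt≡count : ∀ p → cnt p ≡ count p
  cnt≡count p = length-filterᵇ-tabulate p id

  deg-empty : ∀ v → deg empty v ≡ 0
  deg-empty v = trans (cnt≡count _) (sum-replicate-zero n)

  reach-validFrom : ∀ {us detC χ₀ s} → validFrom empty us → Reach us detC χ₀ s →
                    validFrom (graph s) (drop (time s) us)
  reach-validFrom valid init = valid
  reach-validFrom valid (step-upd {s} r _ next) =
    subst (validFrom _) (sym (drop-suc (time s) next))
          (proj₂ (proj₂ (subst (validFrom (graph s)) next (reach-validFrom valid r))))
  reach-validFrom valid (step-det r _ _)    = reach-validFrom valid r
  reach-validFrom valid (step-rand r _ _ _) = reach-validFrom valid r

  reach-deg≤Δ : ∀ {us detC χ₀ s} → validFrom empty us → Reach us detC χ₀ s →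
                ∀ v → deg (graph s) v ≤ Δ
  reach-deg≤Δ valid init v = subst (_≤ Δ) (sym (deg-empty v)) z≤n
  reach-deg≤Δ valid (step-upd {s} r _ next) =
    proj₁ (proj₂ (subst (validFrom (graph s)) next (reach-validFrom valid r)))
  reach-deg≤Δ valid (step-det r _ _)    = reach-deg≤Δ valid r
  reach-deg≤Δ valid (step-rand r _ _ _) = reach-deg≤Δ valid r

  memᵇ⇒∈ : ∀ {c} ds → memᵇ c ds ≡ true → c ∈ ds
  memᵇ⇒∈ {c} (d ∷ ds) c∈ds with c ≟ d
  ... | yes refl = here refl
  ... | no _     = there (memᵇ⇒∈ ds c∈ds)

  ∈-++-missing : ∀ D {C c} → c ∈ C → c ∈ D ++ filterᵇ (λ c → not (memᵇ c D)) C
  ∈-++-missing D {c = c} c∈C with memᵇ c D in mem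
  ... | true  = ∈-++⁺ˡ (memᵇ⇒∈ D mem)
  ... | false = ∈-++⁺ʳ D (∈-filter⁺ (T? ∘ λ c → not (memᵇ c D)) c∈C (subst (T ∘ not) (sym mem) _))

  indexOf-injective : ∀ {c d} P → c ∈ P → d ∈ P → indexOf c P ≡ indexOf d P → c ≡ d
  indexOf-injective {c} {d} (e ∷ P) c∈ d∈ same with c ≟ e | d ≟ e
  ... | yes refl | yes refl = refl
  ... | yes _    | no _     = contradiction same 0≢1+n
  ... | no _     | yes _    = contradiction (sym same) 0≢1+n
  ... | no c≢e   | no d≢e   =
    indexOf-injective P (Any.tail c≢e c∈) (Any.tail d≢e d∈) (suc-injective same)

  ∈-psPerm : ∀ us s x C {c} → c ∈ C → c ∈ psPerm us s x C
  ∈-psPerm us s x C = ∈-++-missing _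

  short-colours-bound : ∀ us s x {C} → Unique C → ∀ lv (S : List (Fin (length C))) → Unique S →
                        All (λ i → IsShort us s x lv C (lookup C i)) S →
                        ∀ N → length S * (96 * eNum N) ≤ 3 ^ lv * fact N
  short-colours-bound us s x {C} C-unique lv S S-unique S-short N = begin
    length S * d                 ≡⟨ cong (_* d) (length-map position S) ⟨
    length (map position S) * d  ≤⟨ Unique⇒length*≤ d {{m*n≢0 96 (eNum N) {{_}} {{eNum-nonZero N}}}}
                                      (Unique.map⁺ position-injective S-unique)
                                      (All.map⁺ (All.map (λ {i} short → reassociate (position i) (short N)) S-short)) ⟩
    3 ^ lv * fact N              ∎
    where
      open ≤-Reasoning
      d = 96 * eNum N
      position : Fin (length C) → ℕ
      position i = indexOf (lookup C i) (psPerm us s x C)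
      position-injective : ∀ {i j} → position i ≡ position j → i ≡ j
      position-injective {i} {j} = lookup-injective C-unique
        ∘ indexOf-injective _ (∈-psPerm us s x C (∈-lookup i)) (∈-psPerm us s x C (∈-lookup j))
      reassociate : ∀ k → 96 * suc k * eNum N ≤ 3 ^ lv * fact N → suc k * d ≤ 3 ^ lv * fact N
      reassociate k = subst (_≤ 3 ^ lv * fact N)
                            (trans (cong (_* eNum N) (*-comm 96 (suc k))) (*-assoc (suc k) 96 (eNum N)))

  search-preserves-3^≤φ : ∀ s x fuel m → 3 ^ m ≤ phi (graph s) (lev s) x m →
                          3 ^ search s x fuel m ≤ phi (graph s) (lev s) x (search s x fuel m)
  search-preserves-3^≤φ s x zero       m 3^m≤φ = 3^m≤φ
  search-preserves-3^≤φ s x (suc fuel) m 3^m≤φ with phi (graph s) (lev s) x (suc m) <ᵇ 3 ^ suc m in test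
  ... | true  = 3^m≤φ
  ... | false = search-preserves-3^≤φ s x fuel (suc m) (<ᵇ-false⇒≥ test)

  3^newLev≤φ : ∀ s x → isDet s x ≡ false → 3 ^ newLev s x ≤ phi (graph s) (lev s) x (newLev s x)
  3^newLev≤φ s x rand = search-preserves-3^≤φ s x (suc n) (suc (lev s x)) (<ᵇ-false⇒≥ rand)

  module _ (s : State) (x : Vertex) where
    private
      g = graph s
      L = levAfter s x
      isDown : Vertex → Bool
      isDown u = g x u ∧ (L u <ᵇ L x)
      hasColour : Color → Vertex → Bool
      hasColour c u = col s u == c

    upNbrs downNbrs : Color → ℕ
    upNbrs   c = cnt (λ u → g x u ∧ (L x ≤ᵇ L u) ∧ hasColour c u)
    downNbrs c = cnt (λ u → g x u ∧ (L u <ᵇ L x) ∧ hasColour c u)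

    downDeg : ℕ
    downDeg = count isDown

    nbrs-of-colour : ∀ c → cnt (λ u → g x u ∧ hasColour c u) ≡ upNbrs c + downNbrs c
    nbrs-of-colour c = begin
      cnt (λ u → g x u ∧ hasColour c u)    ≡⟨ cnt≡count _ ⟩
      count (λ u → g x u ∧ hasColour c u)  ≡⟨ count-split-≤ᵇ (g x) (hasColour c) L (L x) ⟩
      count (λ u → g x u ∧ (L x ≤ᵇ L u) ∧ hasColour c u) + count (λ u → g x u ∧ (L u <ᵇ L x) ∧ hasColour c u)
                                           ≡⟨ cong₂ _+_ (cnt≡count _) (cnt≡count _) ⟨
      upNbrs c + downNbrs c                ∎
      where open ≡-Reasoning

    length-palette : length (palette s x) ≡ count (λ c → BlankOrUnique (upNbrs c) (downNbrs c))
    length-palette = trans (length-filterᵇ-tabulate (λ c → blankᵇ g (col s) x c ∨ uniqueᵇ g (col s) L x c) id)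
                           (count-cong (λ c → cong (λ k → (k ≡ᵇ 0) ∨ ((upNbrs c ≡ᵇ 0) ∧ (downNbrs c ≡ᵇ 1)))
                                                   (nbrs-of-colour c)))

    ∑nbrs≡deg : sum upNbrs + sum downNbrs ≡ deg g x
    ∑nbrs≡deg = begin
      sum upNbrs + sum downNbrs                         ≡⟨ ∑-distrib-+ upNbrs downNbrs ⟨
      ∑[ c < suc Δ ] (upNbrs c + downNbrs c)            ≡⟨ sum-cong-≗ nbrs-of-colour ⟨
      ∑[ c < suc Δ ] cnt (λ u → g x u ∧ hasColour c u)   ≡⟨ sum-cong-≗ (λ c → cnt≡count (λ u → g x u ∧ hasColour c u)) ⟩
      ∑[ c < suc Δ ] count (λ u → g x u ∧ hasColour c u) ≡⟨ count-partition (g x) (col s) ⟩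
      count (g x)                                       ≡⟨ cnt≡count (g x) ⟨
      deg g x                                           ∎
      where open ≡-Reasoning

    ∑downNbrs≡downDeg : sum downNbrs ≡ downDeg
    ∑downNbrs≡downDeg = trans (sum-cong-≗ regroup) (count-partition isDown (col s))
      where
        regroup : ∀ c → downNbrs c ≡ count (λ u → isDown u ∧ hasColour c u)
        regroup c = trans (cnt≡count (λ u → g x u ∧ (L u <ᵇ L x) ∧ hasColour c u))
                          (count-cong (λ u → sym (∧-assoc (g x u) (L u <ᵇ L x) (hasColour c u))))

    -- The + 1 accounts for u = x, whose level has changed.
    φ-newLev≤downDeg+1 : phi g (lev s) x (newLev s x) ≤ downDeg + 1
    φ-newLev≤downDeg+1 = begin
      phi g (lev s) x m                         ≡⟨ cnt≡count _ ⟩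
      count (λ u → g x u ∧ (lev s u <ᵇ m))      ≤⟨ ∑-mono-≤ below ⟩
      ∑[ u < n ] (𝟙 (isDown u) + 𝟙 ⌊ x ≟ u ⌋)   ≡⟨ ∑-distrib-+ (𝟙 ∘ isDown) (λ u → 𝟙 ⌊ x ≟ u ⌋) ⟩
      downDeg + count (λ u → ⌊ x ≟ u ⌋)        ≡⟨ cong (downDeg +_) (count-≟ x) ⟩
      downDeg + 1                               ∎
      where
        open ≤-Reasoning
        m = newLev s x
        below : ∀ u → 𝟙 (g x u ∧ (lev s u <ᵇ m)) ≤ 𝟙 (isDown u) + 𝟙 ⌊ x ≟ u ⌋
        below u with x ≟ u
        ... | yes refl = ≤-trans (𝟙≤1 _) (m≤n+m 1 _)
        ... | no x≢u   = ≤-trans (≤-reflexive (cong₂ (λ l l′ → 𝟙 (g x u ∧ (l <ᵇ l′)))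
                                                     (sym (upd-other (lev s) m (x≢u ∘ sym)))
                                                     (sym (upd-same (lev s) x m))))
                                 (m≤m+n _ 0)

    3^newLev≤2*|palette| : (∀ v → deg g v ≤ Δ) → isDet s x ≡ false →
                           3 ^ newLev s x ≤ 2 * length (palette s x)
    3^newLev≤2*|palette| deg≤Δ rand = begin
      3 ^ newLev s x                                          ≤⟨ 3^newLev≤φ s x rand ⟩
      phi g (lev s) x (newLev s x)                            ≤⟨ φ-newLev≤downDeg+1 ⟩
      downDeg + 1                                             ≤⟨ +-monoʳ-≤ downDeg (n≤1+n 1) ⟩
      downDeg + 2                                             ≡⟨ cong (_+ 2) ∑downNbrs≡downDeg ⟨
      sum downNbrs + 2                                        ≤⟨ ∑down+2≤2*count-BlankOrUnique upNbrs downNbrs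
                                                                   (subst (_≤ Δ) (sym ∑nbrs≡deg) (deg≤Δ x)) ⟩
      2 * count (λ c → BlankOrUnique (upNbrs c) (downNbrs c)) ≡⟨ cong (2 *_) length-palette ⟨
      2 * length (palette s x)                                ∎
      where open ≤-Reasoning

  3^epochLev≤2*|epochPal| : ∀ detC s x → (∀ v → deg (graph s) v ≤ Δ) →
                            3 ^ epochLev s x ≤ 2 * length (epochPal detC s x)
  3^epochLev≤2*|epochPal| detC s x deg≤Δ with isDet s x in det
  ... | true  = s≤s z≤n
  ... | false = 3^newLev≤2*|palette| s x deg≤Δ det

  epochPal-unique : ∀ detC s x → Unique (epochPal detC s x)
  epochPal-unique detC s x with isDet s x
  ... | true  = [] ∷ []
  ... | false = Unique.filter⁺ (λ c → T? (blankᵇ g (col s) x c ∨ uniqueᵇ g (col s) (levAfter s x) x c))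
                               (Unique.allFin⁺ (suc Δ))
    where g = graph s

  shortProbBound : ∀ {us detC χ₀ s} → validFrom empty us → Reach us detC χ₀ s →
                   ∀ x → ShortProbBound us detC s x
  shortProbBound {us} {detC} {s = s} valid reach x S S-unique S-short N = *-cancelˡ-≤ 6 (begin
    6 * (16 * length S * eNum N)  ≡⟨ solve 2 (λ k e → con 6 :* (con 16 :* k :* e) := k :* (con 96 :* e))
                                             refl (length S) (eNum N) ⟩
    length S * (96 * eNum N)      ≤⟨ short-colours-bound us s x (epochPal-unique detC s x) (epochLev s x)
                                                         S S-unique S-short N ⟩
    3 ^ epochLev s x * fact N     ≤⟨ *-monoˡ-≤ (fact N) (3^epochLev≤2*|epochPal| detC s x (reach-deg≤Δ valid reach)) ⟩
    2 * |C| * fact N              ≤⟨ *-monoˡ-≤ (fact N) (*-monoˡ-≤ |C| (m≤m+n 2 4)) ⟩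
    6 * |C| * fact N              ≡⟨ *-assoc 6 |C| (fact N) ⟩
    6 * (|C| * fact N)            ∎)
    where
      open +-*-Solver
      open ≤-Reasoning
      |C| = length (epochPal detC s x)

lemma9 : (n Δ : ℕ) → 2 ≤ n → 1 ≤ Δ →
         (us : List (Alg.Update n Δ)) → Alg.validFrom n Δ (Alg.empty n Δ) us →
         (detC : Alg.DetRule n Δ) → Alg.DetOK n Δ detC →
         (χ₀ : Fin n → Fin (suc Δ)) →
         (s : Alg.State n Δ) → Alg.Reach n Δ us detC χ₀ s →
         (x : Fin n) → Alg.State.pending s ≡ just x →
         Alg.ShortProbBound n Δ us detC s x
lemma9 n Δ _ _ us valid detC _ χ₀ s reach x _ = shortProbBound n Δ valid reach x
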